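{- Let $r\geq 2$ and $n\geq 3$ be integers. Then $s_r^*(n+1)\leq s_r^0(n)+1\leq s_r^*(n)+1$.
   Context: An $n$-partition of a positive integer $s$ is a multiset of $n$ positive integers summing to $s$. For a multiset $X=\{x_1,\dots,x_n\}$ of positive integers define $T(X)=(x_1+\cdots+x_n,\,x_1x_2\cdots x_n,\,n)$. For integers $r\geq2$ and $n\geq3$: $s_r^0(n)$ is the smallest positive integer $s$ such that there are at least $r$ different $n$-partitions $X_1,\dots,X_r$ of $s$ and a positive integer $p$ with $T(X_i)=(s,p,n)$ for all $i=1,\dots,r$; and $s_r^*(n)$ is the smallest positive integer such that for every integer $s\geq s_r^*(n)$ there are at least $r$ different $n$-partitions $X_1,\dots,X_r$ of $s$ and a positive integer $p$ (depending on $s$) with $T(X_i)=(s,p,n)$ for all $i=1,\dots,r$. (The quantities $s_r^0(n)$, $s_r^*(n)$ are taken to exist.) -}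

module Defs where

open import Data.Nat using (ℕ; _<_; _≤_)
open import Data.Fin using (Fin)
open import Data.List using (List; length)
open import Data.Nat.ListAction using (sum; product)
open import Data.List.Relation.Unary.All using (All)
open import Data.List.Relation.Binary.Permutation.Propositional using (_↭_)
open import Data.Product using (Σ; ∃; _×_)
open import Relation.Binary.PropositionalEquality using (_≡_; _≢_)
open import Relation.Nullary using (¬_)

-- A multiset of positive integers is represented by a list; two lists
-- represent the same multiset iff they are permutations of each other.

IsPartition : ℕ → ℕ → List ℕ → Set
IsPartition n s X = length X ≡ n × All (0 <_) X × sum X ≡ s

HasR : ℕ → ℕ → ℕ → Set
HasR r n s =
  Σ ℕ λ p → Σ (Fin r → List ℕ) λ X →
    (∀ i → IsPartition n s (X i) × product (X i) ≡ p) ×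
    (∀ i j → i ≢ j → ¬ (X i ↭ X j))

IsS0 : ℕ → ℕ → ℕ → Set
IsS0 r n s = 0 < s × HasR r n s × (∀ t → 0 < t → t < s → ¬ HasR r n t)

FromOn : ℕ → ℕ → ℕ → Set
FromOn r n s = ∀ t → s ≤ t → HasR r n t

IsSstar : ℕ → ℕ → ℕ → Set
IsSstar r n s = 0 < s × FromOn r n s × (∀ t → 0 < t → t < s → ¬ FromOn r n t)

{-# OPTIONS --safe #-}
module Submission where

open import Defs
open import Data.Nat using (ℕ; suc; _+_; _*_; _∸_; _≤_; _<_)
open import Data.Nat.Properties using (≮⇒≥; m<n⇒0<n∸m; m∸n+n≡m; <⇒≤; m≤n⇒m≤n+o; +-comm; +-monoˡ-≤; ≤-refl)
open import Data.Product using (_×_; _,_)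
open import Data.List using (_∷_)
open import Data.List.Relation.Unary.All using (_∷_)
open import Data.List.Relation.Binary.Permutation.Propositional.Properties using (drop-∷)
open import Relation.Binary.PropositionalEquality using (_≡_; cong; subst)

-- Prepending a common part k to r partitions of s with equal products gives
-- r partitions of k + s with one more part and equal products k * p; they stay
-- pairwise different because a common head can be cancelled from a permutation.
-- Hence one witness for s_r^0(n) yields witnesses for every s > s_r^0(n) with
-- n + 1 parts, and the two inequalities follow from minimality.
-- The hypotheses r ≥ 2 and n ≥ 3 only make the quantities meaningful; the
-- argument does not use them.

HasR-∷ : ∀ {r n s} k → 0 < k → HasR r n s → HasR r (suc n) (k + s)
HasR-∷ k k>0 (p , X , partition , distinct) =
  k * p , (λ i → k ∷ X i) , prepend , (λ i j i≢j Xi↭Xj → distinct i j i≢j (drop-∷ Xi↭Xj))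
  where
  prepend : ∀ i → IsPartition _ _ (k ∷ X i) × _ ≡ k * p
  prepend i with partition i
  ... | (len , pos , total) , prod = (cong suc len , k>0 ∷ pos , cong (k +_) total) , cong (k *_) prod

HasR⇒FromOn-suc : ∀ {r n s} → HasR r n s → FromOn r (suc n) (s + 1)
HasR⇒FromOn-suc {r} {n} {s} h t s+1≤t =
  subst (HasR r (suc n)) (m∸n+n≡m (<⇒≤ s<t)) (HasR-∷ (t ∸ s) (m<n⇒0<n∸m s<t) h)
  where
  s<t : s < t
  s<t = subst (_≤ t) (+-comm s 1) s+1≤t

IsS0-minimal : ∀ {r n a t} → IsS0 r n a → 0 < t → HasR r n t → a ≤ t
IsS0-minimal (_ , _ , below) t>0 h = ≮⇒≥ (λ t<a → below _ t>0 t<a h)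

IsSstar-minimal : ∀ {r n b t} → IsSstar r n b → 0 < t → FromOn r n t → b ≤ t
IsSstar-minimal (_ , _ , below) t>0 h = ≮⇒≥ (λ t<b → below _ t>0 t<b h)

theorem4p1 : (r n : ℕ) → 2 ≤ r → 3 ≤ n →
    (a b c : ℕ) → IsS0 r n a → IsSstar r n b → IsSstar r (suc n) c →
    (c ≤ a + 1) × (a + 1 ≤ b + 1)
theorem4p1 r n _ _ a b c isS0@(a>0 , hasR-a , _) (b>0 , fromOn-b , _) isSstar-suc =
  IsSstar-minimal isSstar-suc (m≤n⇒m≤n+o 1 a>0) (HasR⇒FromOn-suc hasR-a) ,
  +-monoˡ-≤ 1 (IsS0-minimal isS0 b>0 (fromOn-b b ≤-refl))
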